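{- For non-negative integers $m$, $n$ and any integer $r$, \[ \sum_{k = 1}^n k^m F_{k + r} = -\delta _{m,0}F_r + n^m F_{n + r + 2} + ( - 1)^{m + 1} \sum_{j = 0}^m A(m,j)F_{j + m + r + 1} - \sum_{s = 1}^m ( - 1)^{s + 1} \binom ms n^{m - s} \sum_{j = 1}^s A(s,j)F_{j + n + s + r + 1}, \] \[ \sum_{k = 1}^n k^m L_{k + r} = -\delta _{m,0}L_r + n^m L_{n + r + 2} + ( - 1)^{m + 1} \sum_{j = 0}^m A(m,j)L_{j + m + r + 1} - \sum_{s = 1}^m ( - 1)^{s + 1} \binom ms n^{m - s} \sum_{j = 1}^s A(s,j)L_{j + n + s + r + 1}. \]
   Context: $F_j$, $L_j$ are the Fibonacci and Lucas numbers for all integers $j$ ($F_0=0,F_1=1,L_0=2,L_1=1$, $X_j=X_{j-1}+X_{j-2}$, extended to negative indices by the same recurrence). $\delta_{m,0}$ is the Kronecker delta. The Eulerian numbers are $A(i,j)=\sum_{t=0}^j(-1)^t\binom{i+1}{t}(j-t)^i$ for non-negative integers $i,j$, with $0^0=1$. Empty sums are $0$. -}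

module Defs where

open import Data.Nat as ℕ using (ℕ; zero; suc)
open import Data.Nat.Combinatorics using (_C_)
open import Data.Integer as ℤ using (ℤ; +_; -[1+_]; _+_; _-_; _*_; -_; _^_)
open import Data.Product using (_×_; _,_; proj₁; proj₂)

-- Sequences satisfying X_j = X_{j-1} + X_{j-2} for all integers j,
-- determined by X_0 = a, X_1 = b.
-- fwd n = (X_n , X_{n+1}) for n ≥ 0
fwd : ℤ → ℤ → ℕ → ℤ × ℤ
fwd a b zero = a , b
fwd a b (suc n) = let p = fwd a b n in proj₂ p , proj₁ p + proj₂ p

-- bwd n = (X_{-n} , X_{-n+1}) for n ≥ 0, using X_{j-2} = X_j - X_{j-1}
bwd : ℤ → ℤ → ℕ → ℤ × ℤ
bwd a b zero = a , b
bwd a b (suc n) = let p = bwd a b n in proj₂ p - proj₁ p , proj₁ p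

seqℤ : ℤ → ℤ → ℤ → ℤ
seqℤ a b (+ n) = proj₁ (fwd a b n)
seqℤ a b -[1+ n ] = proj₁ (bwd a b (suc n))

F : ℤ → ℤ
F = seqℤ (+ 0) (+ 1)

L : ℤ → ℤ
L = seqℤ (+ 2) (+ 1)

δ0 : ℕ → ℤ
δ0 zero = + 1
δ0 (suc _) = + 0

sgn : ℕ → ℤ
sgn n = (- (+ 1)) ^ n

-- Σ_{k=a}^{b} f k  (empty sum = 0 when b < a)
Σ[_≤_≤_] : ℕ → (ℕ → ℤ) → ℕ → ℤ
Σ[ a ≤ f ≤ b ] = go (suc b ℕ.∸ a) a
  where
  go : ℕ → ℕ → ℤ
  go zero i = + 0
  go (suc c) i = f i + go c (suc i)

-- Eulerian numbers A(i,j) = Σ_{t=0}^{j} (-1)^t C(i+1,t) (j-t)^i, with 0^0 = 1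
A : ℕ → ℕ → ℤ
A i j = Σ[ 0 ≤ (λ t → sgn t * + ((i ℕ.+ 1) C t) * + ((j ℕ.∸ t) ℕ.^ i)) ≤ j ]

RHS : (ℤ → ℤ) → ℕ → ℕ → ℤ → ℤ
RHS X m n r =
  - (δ0 m * X r)
  + (+ n) ^ m * X (+ n + r + + 2)
  + sgn (suc m) * Σ[ 0 ≤ (λ j → A m j * X (+ j + + m + r + + 1)) ≤ m ]
  - Σ[ 1 ≤ (λ s → sgn (suc s) * + (m C s) * (+ n) ^ (m ℕ.∸ s)
         * Σ[ 1 ≤ (λ j → A s j * X (+ j + + n + + s + r + + 1)) ≤ s ]) ≤ m ]

LHS : (ℤ → ℤ) → ℕ → ℕ → ℤ → ℤ
LHS X m n r = Σ[ 1 ≤ (λ k → (+ k) ^ m * X (+ k + r)) ≤ n ]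

{-# OPTIONS --safe #-}
-- Let E be the shift, E X z = X (z + 1). The sum telescopes against Q with
-- Q (n + 1) − Q n = nᵐ X (n + r), and formally
--   Q n = − Σ_{k ≥ n} kᵐ Eᵏ X r = − Σₛ (m choose s) nᵐ⁻ˢ Eⁿ Σₖ kˢ Eᵏ X r.
-- Since Σₖ kˢ xᵏ = Aₛ(x) / (1 − x)ˢ⁺¹ for the Eulerian polynomial Aₛ, and E² = E + 1
-- gives (1 − E)⁻¹ = − E on Fibonacci-like sequences, this becomes the finite expression
--   Q n = Σₛ (m choose s) nᵐ⁻ˢ (−1)ˢ Aₛ(E) Eⁿ⁺ˢ⁺¹ X r,
-- which unfolds to the right-hand side. The divergent series are made rigorous by
-- applying the Eulerian identity, in the form Σₖ kˢ Eᵏ (1 − E)ˢ⁺¹ = Aₛ(E), only to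
-- finitely supported sequences; this suffices because Q reads finitely many values.
module Submission where

open import Defs
open import Data.Nat as ℕ using (ℕ; zero; suc; _≤_; _<_; z≤n; s≤s)
import Data.Nat.Properties as ℕP
open import Data.Nat.Combinatorics using (_C_; nCk+nC[k+1]≡[n+1]C[k+1]; k>n⇒nCk≡0; nCn≡1)
open import Data.Integer as ℤ using (ℤ; +_; -[1+_]; _+_; _-_; _*_; -_; _^_; 0ℤ; 1ℤ)
import Data.Integer.Properties as ℤP
open import Data.Integer.Tactic.RingSolver using (solve-∀)
open import Data.Product using (_×_; _,_; proj₁; proj₂)
open import Data.Sum using (inj₁; inj₂)
open import Relation.Binary.PropositionalEquality
open import Relation.Nullary using (yes; no; contradiction)

∑< : ℕ → (ℕ → ℤ) → ℤ
∑< zero    f = 0ℤ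
∑< (suc n) f = ∑< n f + f n

syntax ∑< n (λ k → e) = ∑[ k < n ] e

∑-cong-< : ∀ n {f g : ℕ → ℤ} → (∀ k → k < n → f k ≡ g k) → ∑< n f ≡ ∑< n g
∑-cong-< zero    f≡g = refl
∑-cong-< (suc n) f≡g =
  cong₂ _+_ (∑-cong-< n (λ k k<n → f≡g k (ℕP.m<n⇒m<1+n k<n))) (f≡g n ℕP.≤-refl)

∑-cong : ∀ n {f g : ℕ → ℤ} → (∀ k → f k ≡ g k) → ∑< n f ≡ ∑< n g
∑-cong n f≡g = ∑-cong-< n (λ k _ → f≡g k)

∑-zero : ∀ n {f : ℕ → ℤ} → (∀ k → k < n → f k ≡ 0ℤ) → ∑< n f ≡ 0ℤ
∑-zero zero    f≡0 = refl
∑-zero (suc n) f≡0 =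
  cong₂ _+_ (∑-zero n (λ k k<n → f≡0 k (ℕP.m<n⇒m<1+n k<n))) (f≡0 n ℕP.≤-refl)

∑-+ : ∀ n (f g : ℕ → ℤ) → ∑[ k < n ] (f k + g k) ≡ ∑< n f + ∑< n g
∑-+ zero    f g = refl
∑-+ (suc n) f g rewrite ∑-+ n f g = interchange (∑< n f) (∑< n g) (f n) (g n)
  where
  interchange : ∀ a b c d → a + b + (c + d) ≡ a + c + (b + d)
  interchange = solve-∀

∑-neg : ∀ n (f : ℕ → ℤ) → ∑[ k < n ] (- f k) ≡ - ∑< n f
∑-neg zero    f = refl
∑-neg (suc n) f rewrite ∑-neg n f = sym (ℤP.neg-distrib-+ (∑< n f) (f n))

∑-- : ∀ n (f g : ℕ → ℤ) → ∑[ k < n ] (f k - g k) ≡ ∑< n f - ∑< n g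
∑-- n f g = trans (∑-+ n f (λ k → - g k)) (cong (_+_ (∑< n f)) (∑-neg n g))

∑-distribˡ : ∀ n (c : ℤ) (f : ℕ → ℤ) → ∑[ k < n ] (c * f k) ≡ c * ∑< n f
∑-distribˡ zero    c f = sym (ℤP.*-zeroʳ c)
∑-distribˡ (suc n) c f rewrite ∑-distribˡ n c f = sym (ℤP.*-distribˡ-+ c (∑< n f) (f n))

∑-distribʳ : ∀ n (c : ℤ) (f : ℕ → ℤ) → ∑[ k < n ] (f k * c) ≡ ∑< n f * c
∑-distribʳ n c f = begin
  ∑[ k < n ] (f k * c)  ≡⟨ ∑-cong n (λ k → ℤP.*-comm (f k) c) ⟩
  ∑[ k < n ] (c * f k)  ≡⟨ ∑-distribˡ n c f ⟩
  c * ∑< n f            ≡⟨ ℤP.*-comm c (∑< n f) ⟩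
  ∑< n f * c            ∎
  where open ≡-Reasoning

∑-suc : ∀ n (f : ℕ → ℤ) → ∑< (suc n) f ≡ f 0 + ∑[ k < n ] f (suc k)
∑-suc zero    f = ℤP.+-comm 0ℤ (f 0)
∑-suc (suc n) f rewrite ∑-suc n f = ℤP.+-assoc (f 0) (∑[ k < n ] f (suc k)) (f (suc n))

∑-swap : ∀ n m (f : ℕ → ℕ → ℤ) → ∑[ i < n ] ∑[ j < m ] f i j ≡ ∑[ j < m ] ∑[ i < n ] f i j
∑-swap zero    m f = sym (∑-zero m (λ _ _ → refl))
∑-swap (suc n) m f rewrite ∑-swap n m f = sym (∑-+ m (λ j → ∑[ i < n ] f i j) (λ j → f n j))

∑-vanishing-tail : ∀ c a (f : ℕ → ℤ) → (∀ t → c ≤ t → f t ≡ 0ℤ) → c ≤ a →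
                   ∑< a f ≡ ∑< c f
∑-vanishing-tail c zero    f tail≡0 z≤n = refl
∑-vanishing-tail c (suc a) f tail≡0 c≤1+a with ℕP.m≤n⇒m<n∨m≡n c≤1+a
... | inj₂ refl = refl
... | inj₁ (s≤s c≤a) rewrite ∑-vanishing-tail c a f tail≡0 c≤a | tail≡0 a c≤a =
  ℤP.+-identityʳ (∑< c f)

∑-common-support : ∀ a b (f : ℕ → ℤ) →
  (∀ t → a ≤ t → f t ≡ 0ℤ) → (∀ t → b ≤ t → f t ≡ 0ℤ) → ∑< a f ≡ ∑< b f
∑-common-support a b f fromA≡0 fromB≡0 with ℕP.≤-total a b
... | inj₁ a≤b = sym (∑-vanishing-tail a b f fromA≡0 a≤b)
... | inj₂ b≤a = ∑-vanishing-tail b a f fromB≡0 b≤a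

∑-reverse : ∀ n (f : ℕ → ℤ) → ∑< n f ≡ ∑[ k < n ] f (n ℕ.∸ suc k)
∑-reverse zero    f = refl
∑-reverse (suc n) f = begin
  ∑< n f + f n                                    ≡⟨ cong (_+ f n) (∑-reverse n f) ⟩
  ∑[ k < n ] f (n ℕ.∸ suc k) + f n                ≡⟨ ℤP.+-comm _ (f n) ⟩
  f n + ∑[ k < n ] f (n ℕ.∸ suc k)                ≡⟨ ∑-suc n (λ k → f (n ℕ.∸ k)) ⟨
  ∑[ k < suc n ] f (suc n ℕ.∸ suc k)              ∎
  where open ≡-Reasoning

∑-antidiagonal : ∀ M (f : ℕ → ℕ → ℤ) →
  ∑[ j < M ] ∑[ t < suc j ] f (j ℕ.∸ t) t ≡ ∑[ k < M ] ∑[ t < M ℕ.∸ k ] f k t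
∑-antidiagonal zero    f = refl
∑-antidiagonal (suc M) f = begin
  ∑[ j < M ] ∑[ t < suc j ] f (j ℕ.∸ t) t + ∑[ t < suc M ] f (M ℕ.∸ t) t
    ≡⟨ cong₂ _+_ (∑-antidiagonal M f) lastDiagonal ⟩
  ∑[ k < M ] ∑[ t < M ℕ.∸ k ] f k t + ∑[ k < suc M ] f k (M ℕ.∸ k)
    ≡⟨ cong (_+ ∑[ k < suc M ] f k (M ℕ.∸ k)) extendOuter ⟩
  ∑[ k < suc M ] ∑[ t < M ℕ.∸ k ] f k t + ∑[ k < suc M ] f k (M ℕ.∸ k)
    ≡⟨ ∑-+ (suc M) _ _ ⟨
  ∑[ k < suc M ] (∑[ t < M ℕ.∸ k ] f k t + f k (M ℕ.∸ k))
    ≡⟨ ∑-cong-< (suc M) (λ k k<1+M →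
         cong (λ c → ∑< c (f k)) (sym (ℕP.+-∸-assoc 1 (ℕP.≤-pred k<1+M)))) ⟩
  ∑[ k < suc M ] ∑[ t < suc M ℕ.∸ k ] f k t
    ∎
  where
  open ≡-Reasoning
  lastDiagonal : ∑[ t < suc M ] f (M ℕ.∸ t) t ≡ ∑[ k < suc M ] f k (M ℕ.∸ k)
  lastDiagonal = trans (∑-reverse (suc M) (λ t → f (M ℕ.∸ t) t))
    (∑-cong-< (suc M) (λ k k<1+M → cong (λ i → f i (M ℕ.∸ k)) (ℕP.m∸[m∸n]≡n (ℕP.≤-pred k<1+M))))
  extendOuter : ∑[ k < M ] ∑[ t < M ℕ.∸ k ] f k t ≡ ∑[ k < suc M ] ∑[ t < M ℕ.∸ k ] f k t
  extendOuter = sym (trans (cong (λ c → ∑[ k < M ] ∑[ t < M ℕ.∸ k ] f k t + ∑< c (f M)) (ℕP.n∸n≡0 M))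
                           (ℤP.+-identityʳ _))

∑-telescope : ∀ n (f : ℕ → ℤ) → ∑[ k < n ] (f (suc k) - f k) ≡ f n - f 0
∑-telescope zero    f = sym (ℤP.+-inverseʳ (f 0))
∑-telescope (suc n) f rewrite ∑-telescope n f = collapse (f n) (f 0) (f (suc n))
  where
  collapse : ∀ a b c → a - b + (c - a) ≡ c - b
  collapse = solve-∀

Σ-step : ∀ a b (f : ℕ → ℤ) → a ≤ b → Σ[ a ≤ f ≤ b ] ≡ f a + Σ[ suc a ≤ f ≤ b ]
Σ-step a b f a≤b rewrite ℕP.+-∸-assoc 1 a≤b = refl

-- Σ[ a ≤ f ≤ b ] recurses on its length suc b ∸ a, so the induction is on that length c.
Σ-as-∑ : ∀ c a b (f : ℕ → ℤ) → suc b ℕ.∸ a ≡ c → Σ[ a ≤ f ≤ b ] ≡ ∑[ k < c ] f (a ℕ.+ k)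
Σ-as-∑ zero    a b f length≡0 rewrite length≡0 = refl
Σ-as-∑ (suc c) a b f length≡1+c = begin
  Σ[ a ≤ f ≤ b ]                           ≡⟨ Σ-step a b f a≤b ⟩
  f a + Σ[ suc a ≤ f ≤ b ]                 ≡⟨ cong₂ _+_ (cong f (sym (ℕP.+-identityʳ a)))
                                                        (Σ-as-∑ c (suc a) b f restLength) ⟩
  f (a ℕ.+ 0) + ∑[ k < c ] f (suc a ℕ.+ k) ≡⟨ cong (_+_ (f (a ℕ.+ 0)))
                                                   (∑-cong c (λ k → cong f (sym (ℕP.+-suc a k)))) ⟩
  f (a ℕ.+ 0) + ∑[ k < c ] f (a ℕ.+ suc k) ≡⟨ ∑-suc c (λ k → f (a ℕ.+ k)) ⟨
  ∑[ k < suc c ] f (a ℕ.+ k)               ∎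
  where
  open ≡-Reasoning
  a≤b : a ≤ b
  a≤b = ℕP.≤-pred (ℕP.m∸n≢0⇒n<m (λ length≡0 → ℕP.0≢1+n (trans (sym length≡0) length≡1+c)))
  restLength : b ℕ.∸ a ≡ c
  restLength = ℕP.suc-injective (trans (sym (ℕP.+-∸-assoc 1 a≤b)) length≡1+c)

Σ₀-as-∑ : ∀ b (f : ℕ → ℤ) → Σ[ 0 ≤ f ≤ b ] ≡ ∑< (suc b) f
Σ₀-as-∑ b f = Σ-as-∑ (suc b) 0 b f refl

Σ₁-as-∑ : ∀ b (f : ℕ → ℤ) → Σ[ 1 ≤ f ≤ b ] ≡ ∑[ k < b ] f (suc k)
Σ₁-as-∑ b f = Σ-as-∑ b 1 b f refl

∑-pascal : ∀ p (w : ℕ → ℤ) →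
  ∑[ t < suc (suc p) ] (+ (suc p C t) * w t) ≡
  ∑[ t < suc p ] (+ (p C t) * w t) + ∑[ t < suc p ] (+ (p C t) * w (suc t))
∑-pascal p w = begin
  ∑[ t < suc (suc p) ] (+ (suc p C t) * w t)
    ≡⟨ ∑-suc (suc p) _ ⟩
  1ℤ * w 0 + ∑[ t < suc p ] (+ (suc p C suc t) * w (suc t))
    ≡⟨ cong (_+_ (1ℤ * w 0)) (trans (∑-cong (suc p) pascalRule) (∑-+ (suc p) _ _)) ⟩
  1ℤ * w 0 + (∑[ t < suc p ] (+ (p C suc t) * w (suc t)) + ∑[ t < suc p ] (+ (p C t) * w (suc t)))
    ≡⟨ ℤP.+-assoc (1ℤ * w 0) _ _ ⟨
  1ℤ * w 0 + ∑[ t < suc p ] (+ (p C suc t) * w (suc t)) + ∑[ t < suc p ] (+ (p C t) * w (suc t))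
    ≡⟨ cong (_+ ∑[ t < suc p ] (+ (p C t) * w (suc t))) (cong (_+_ (1ℤ * w 0)) dropLast) ⟩
  1ℤ * w 0 + ∑[ t < p ] (+ (p C suc t) * w (suc t)) + ∑[ t < suc p ] (+ (p C t) * w (suc t))
    ≡⟨ cong (_+ ∑[ t < suc p ] (+ (p C t) * w (suc t))) (∑-suc p (λ t → + (p C t) * w t)) ⟨
  ∑[ t < suc p ] (+ (p C t) * w t) + ∑[ t < suc p ] (+ (p C t) * w (suc t))
    ∎
  where
  open ≡-Reasoning
  pascalRule : ∀ t → + (suc p C suc t) * w (suc t) ≡ + (p C suc t) * w (suc t) + + (p C t) * w (suc t)
  pascalRule t = begin
    + (suc p C suc t) * w (suc t)
      ≡⟨ cong (λ c → + c * w (suc t)) (nCk+nC[k+1]≡[n+1]C[k+1] p t) ⟨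
    (+ (p C t) + + (p C suc t)) * w (suc t)
      ≡⟨ ℤP.*-distribʳ-+ (w (suc t)) (+ (p C t)) (+ (p C suc t)) ⟩
    + (p C t) * w (suc t) + + (p C suc t) * w (suc t)
      ≡⟨ ℤP.+-comm (+ (p C t) * w (suc t)) _ ⟩
    + (p C suc t) * w (suc t) + + (p C t) * w (suc t)
      ∎
  dropLast : ∑[ t < suc p ] (+ (p C suc t) * w (suc t)) ≡ ∑[ t < p ] (+ (p C suc t) * w (suc t))
  dropLast = ∑-vanishing-tail p (suc p) _
    (λ t p≤t → cong (λ c → + c * w (suc t)) (k>n⇒nCk≡0 (s≤s p≤t))) (ℕP.n≤1+n p)

-- ∇ p is the p-th power of 1 − E, where E is the shift E K c = K (suc c).
∇ : ℕ → (ℕ → ℤ) → ℕ → ℤ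
∇ p K c = ∑[ t < suc p ] (+ (p C t) * (sgn t * K (c ℕ.+ t)))

∇-local : ∀ p (K K′ : ℕ → ℤ) c → (∀ t → t ≤ p → K (c ℕ.+ t) ≡ K′ (c ℕ.+ t)) →
          ∇ p K c ≡ ∇ p K′ c
∇-local p K K′ c K≡K′ =
  ∑-cong-< (suc p) (λ t t<1+p → cong (λ x → + (p C t) * (sgn t * x)) (K≡K′ t (ℕP.≤-pred t<1+p)))

∇-zero : ∀ p (K : ℕ → ℤ) c → (∀ t → t ≤ p → K (c ℕ.+ t) ≡ 0ℤ) → ∇ p K c ≡ 0ℤ
∇-zero p K c K≡0 =
  trans (∇-local p K (λ _ → 0ℤ) c K≡0) (∑-zero (suc p) (λ t _ → times0 (+ (p C t)) (sgn t)))
  where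
  times0 : ∀ a b → a * (b * 0ℤ) ≡ 0ℤ
  times0 = solve-∀

∇-zeroth : ∀ K c → ∇ 0 K c ≡ K c
∇-zeroth K c rewrite ℕP.+-identityʳ c = unit (K c)
  where
  unit : ∀ a → 0ℤ + 1ℤ * (1ℤ * a) ≡ a
  unit = solve-∀

∇-suc : ∀ p K c → ∇ (suc p) K c ≡ ∇ p K c - ∇ p K (suc c)
∇-suc p K c = trans (∑-pascal p (λ t → sgn t * K (c ℕ.+ t)))
  (cong (_+_ (∇ p K c)) (trans (∑-cong (suc p) flipSign) (∑-neg (suc p) _)))
  where
  flipSign : ∀ t → + (p C t) * (sgn (suc t) * K (c ℕ.+ suc t)) ≡
                   - (+ (p C t) * (sgn t * K (suc c ℕ.+ t)))
  flipSign t rewrite ℕP.+-suc c t = shuffle (+ (p C t)) (sgn t) (K (suc c ℕ.+ t))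
    where
    shuffle : ∀ a s x → a * (- 1ℤ * s * x) ≡ - (a * (s * x))
    shuffle = solve-∀

∇-∇ : ∀ a b K c → ∇ a (∇ b K) c ≡ ∇ (a ℕ.+ b) K c
∇-∇ zero    b K c = ∇-zeroth (∇ b K) c
∇-∇ (suc a) b K c = begin
  ∇ (suc a) (∇ b K) c                      ≡⟨ ∇-suc a (∇ b K) c ⟩
  ∇ a (∇ b K) c - ∇ a (∇ b K) (suc c)      ≡⟨ cong₂ _-_ (∇-∇ a b K c) (∇-∇ a b K (suc c)) ⟩
  ∇ (a ℕ.+ b) K c - ∇ (a ℕ.+ b) K (suc c)  ≡⟨ ∇-suc (a ℕ.+ b) K c ⟨
  ∇ (suc a ℕ.+ b) K c                      ∎
  where open ≡-Reasoning

Δ : (ℕ → ℤ) → ℕ → ℤ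
Δ K n = K (suc n) - K n

∇-suc-Δ : ∀ p K c → ∇ (suc p) K c ≡ - ∇ p (Δ K) c
∇-suc-Δ p K c = begin
  ∇ (suc p) K c                      ≡⟨ ∇-suc p K c ⟩
  ∇ p K c - ∇ p K (suc c)            ≡⟨ antisym (∇ p K c) (∇ p K (suc c)) ⟩
  - (∇ p K (suc c) - ∇ p K c)        ≡⟨ cong -_ (∑-- (suc p) _ _) ⟨
  - ∑[ t < suc p ] (+ (p C t) * (sgn t * K (suc c ℕ.+ t)) - + (p C t) * (sgn t * K (c ℕ.+ t)))
                                     ≡⟨ cong -_ (∑-cong (suc p) (λ t → distrib (+ (p C t)) (sgn t) _ _)) ⟩
  - ∇ p (Δ K) c                      ∎
  where
  open ≡-Reasoning
  antisym : ∀ a b → a - b ≡ - (b - a)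
  antisym = solve-∀
  distrib : ∀ a s x y → a * (s * x) - a * (s * y) ≡ a * (s * (x - y))
  distrib = solve-∀

DegreeAtMost : ℕ → (ℕ → ℤ) → Set
DegreeAtMost zero    f = ∀ n → f (suc n) ≡ f n
DegreeAtMost (suc d) f = DegreeAtMost d (Δ f)

degree-cong : ∀ d {f g : ℕ → ℤ} → (∀ n → f n ≡ g n) → DegreeAtMost d f → DegreeAtMost d g
degree-cong zero    f≡g deg n = trans (sym (f≡g (suc n))) (trans (deg n) (f≡g n))
degree-cong (suc d) f≡g deg = degree-cong d (λ n → cong₂ _-_ (f≡g (suc n)) (f≡g n)) deg

degree-+ : ∀ d {f g : ℕ → ℤ} → DegreeAtMost d f → DegreeAtMost d g →
           DegreeAtMost d (λ n → f n + g n)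
degree-+ zero    degf degg n = cong₂ _+_ (degf n) (degg n)
degree-+ (suc d) {f} {g} degf degg =
  degree-cong d (λ n → regroup (f (suc n)) (g (suc n)) (f n) (g n)) (degree-+ d degf degg)
  where
  regroup : ∀ a b c e → (a - c) + (b - e) ≡ (a + b) - (c + e)
  regroup = solve-∀

degree-neg : ∀ d {f : ℕ → ℤ} → DegreeAtMost d f → DegreeAtMost d (λ n → - f n)
degree-neg zero    deg n = cong -_ (deg n)
degree-neg (suc d) {f} deg = degree-cong d (λ n → negate (f (suc n)) (f n)) (degree-neg d deg)
  where
  negate : ∀ a c → - (a - c) ≡ - a - - c
  negate = solve-∀

-- Product rule: Δ ((z − t) g) = − g when g is constant, and (z − 1 − t) Δg − g in general.
degree-*-linear : ∀ d (z : ℤ) {g : ℕ → ℤ} → DegreeAtMost d g →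
                  DegreeAtMost (suc d) (λ t → (z - + t) * g t)
degree-*-linear zero z {g} deg = degree-cong 0 (λ n → sym (constantRule n)) (degree-neg 0 {g} deg)
  where
  constantRule : ∀ n → (z - + suc n) * g (suc n) - (z - + n) * g n ≡ - g n
  constantRule n rewrite deg n = rule z (+ n) (g n)
    where
    rule : ∀ z n a → (z - (1ℤ + n)) * a - (z - n) * a ≡ - a
    rule = solve-∀
degree-*-linear (suc d) z {g} deg =
  degree-cong (suc d) (λ n → sym (productRule n))
    (degree-+ (suc d) {λ n → ((z - 1ℤ) - + n) * Δ g n} (degree-*-linear d (z - 1ℤ) deg)
                      (degree-neg (suc d) {g} deg))
  where
  productRule : ∀ n → (z - + suc n) * g (suc n) - (z - + n) * g n ≡
                      ((z - 1ℤ) - + n) * Δ g n + - g n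
  productRule n = rule z (+ n) (g (suc n)) (g n)
    where
    rule : ∀ z n a b → (z - (1ℤ + n)) * a - (z - n) * b ≡ ((z - 1ℤ) - n) * (a - b) + - b
    rule = solve-∀

degree-pow : ∀ i (z : ℤ) → DegreeAtMost i (λ t → (z - + t) ^ i)
degree-pow zero    z n = refl
degree-pow (suc i) z = degree-*-linear i z (degree-pow i z)

∇-degree : ∀ d K → DegreeAtMost d K → ∀ p c → d < p → ∇ p K c ≡ 0ℤ
∇-degree zero    K deg (suc p) c _ =
  trans (∇-suc-Δ p K c) (cong -_ (∇-zero p (Δ K) c (λ t _ → ℤP.i≡j⇒i-j≡0 (deg (c ℕ.+ t)))))
∇-degree (suc d) K deg (suc p) c (s≤s d<p) =
  trans (∇-suc-Δ p K c) (cong -_ (∇-degree d (Δ K) deg p c d<p))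

pos-^ : ∀ m i → + (m ℕ.^ i) ≡ (+ m) ^ i
pos-^ m zero    = refl
pos-^ m (suc i) = trans (ℤP.pos-* m (m ℕ.^ i)) (cong (+ m *_) (pos-^ m i))

pos-∸ : ∀ {m n} → n ≤ m → + (m ℕ.∸ n) ≡ + m - + n
pos-∸ {m} {n} n≤m = sym (trans (ℤP.m-n≡m⊖n m n) (ℤP.⊖-≥ n≤m))

-- For j > i, A i j is the (i + 1)-st difference of the degree-i polynomial t ↦ (j − t)ⁱ.
eulerian-vanishing : ∀ i j → i < j → A i j ≡ 0ℤ
eulerian-vanishing i j i<j = begin
  A i j
    ≡⟨ Σ₀-as-∑ j term ⟩
  ∑< (suc j) term
    ≡⟨ ∑-vanishing-tail (suc (suc i)) (suc j) term binomialVanishes (s≤s i<j) ⟩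
  ∑< (suc (suc i)) term
    ≡⟨ ∑-cong-< (suc (suc i)) (λ t t<2+i → asPower t (ℕP.≤-trans (ℕP.≤-pred t<2+i) i<j)) ⟩
  ∇ (suc i) (λ t → (+ j - + t) ^ i) 0
    ≡⟨ ∇-degree i _ (degree-pow i (+ j)) (suc i) 0 ℕP.≤-refl ⟩
  0ℤ
    ∎
  where
  open ≡-Reasoning
  term : ℕ → ℤ
  term t = sgn t * + ((i ℕ.+ 1) C t) * + ((j ℕ.∸ t) ℕ.^ i)
  i+1≡1+i : i ℕ.+ 1 ≡ suc i
  i+1≡1+i = ℕP.+-comm i 1
  binomialVanishes : ∀ t → suc (suc i) ≤ t → term t ≡ 0ℤ
  binomialVanishes t 2+i≤t =
    trans (cong (λ c → sgn t * + c * + ((j ℕ.∸ t) ℕ.^ i))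
                (trans (cong (_C t) i+1≡1+i) (k>n⇒nCk≡0 2+i≤t)))
          (annihilate (sgn t) _)
    where
    annihilate : ∀ s x → s * 0ℤ * x ≡ 0ℤ
    annihilate = solve-∀
  asPower : ∀ t → t ≤ j → term t ≡ + (suc i C t) * (sgn t * (+ j - + t) ^ i)
  asPower t t≤j =
    trans (cong₂ (λ n x → sgn t * + (n C t) * x) i+1≡1+i
                 (trans (pos-^ (j ℕ.∸ t) i) (cong (_^ i) (pos-∸ t≤j))))
          (reorder (sgn t) (+ (suc i C t)) _)
    where
    reorder : ∀ a b c → a * b * c ≡ b * (a * c)
    reorder = solve-∀

VanishesAbove : ℕ → (ℕ → ℤ) → Set
VanishesAbove N K = ∀ j → N < j → K j ≡ 0ℤ

∇-vanishesAbove : ∀ p {N} {K : ℕ → ℤ} → VanishesAbove N K → VanishesAbove N (∇ p K)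
∇-vanishesAbove p {K = K} K≡0 c N<c =
  ∇-zero p K c (λ t _ → K≡0 (c ℕ.+ t) (ℕP.<-≤-trans N<c (ℕP.m≤m+n c t)))

eulerianSum : ℕ → (ℕ → ℤ) → ℤ
eulerianSum s K = ∑[ j < suc s ] (A s j * K j)

-- Operator form of Σₖ kⁱ xᵏ = Aᵢ(x) / (1 − x)ⁱ⁺¹, valid since K has finite support.
eulerianSum-∇ : ∀ i N (K : ℕ → ℤ) → VanishesAbove N K →
  eulerianSum i K ≡ ∑[ k < suc N ] ((+ k) ^ i * ∇ (suc i) K k)
eulerianSum-∇ i N K K≡0 = begin
  eulerianSum i K
    ≡⟨ ∑-common-support (suc i) M _ beyondDiagonal (λ j M≤j → beyondN j (N<M M≤j)) ⟩
  ∑[ j < M ] (A i j * K j)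
    ≡⟨ ∑-cong M expandEulerian ⟩
  ∑[ j < M ] ∑[ t < suc j ] f (j ℕ.∸ t) t
    ≡⟨ ∑-antidiagonal M f ⟩
  ∑[ k < M ] ∑[ t < M ℕ.∸ k ] f k t
    ≡⟨ ∑-cong M (λ k → ∑-common-support (M ℕ.∸ k) (suc (suc i)) (f k)
                                        (beyondSupport k) (beyondBinomial k)) ⟩
  ∑[ k < M ] ∑[ t < suc (suc i) ] f k t
    ≡⟨ ∑-cong M (λ k → ∑-distribˡ (suc (suc i)) ((+ k) ^ i) _) ⟩
  ∑[ k < M ] ((+ k) ^ i * ∇ (suc i) K k)
    ≡⟨ ∑-common-support M (suc N) _ (λ k M≤k → ∇beyondN k (N<M M≤k)) ∇beyondN ⟩
  ∑[ k < suc N ] ((+ k) ^ i * ∇ (suc i) K k)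
    ∎
  where
  open ≡-Reasoning
  M : ℕ
  M = suc (N ℕ.+ i)
  N<M : ∀ {k} → M ≤ k → N < k
  N<M = ℕP.<-≤-trans (s≤s (ℕP.m≤m+n N i))
  f : ℕ → ℕ → ℤ
  f k t = (+ k) ^ i * (+ (suc i C t) * (sgn t * K (k ℕ.+ t)))
  beyondDiagonal : ∀ j → suc i ≤ j → A i j * K j ≡ 0ℤ
  beyondDiagonal j i<j = trans (cong (_* K j) (eulerian-vanishing i j i<j)) (ℤP.*-zeroˡ (K j))
  beyondN : ∀ j → N < j → A i j * K j ≡ 0ℤ
  beyondN j N<j = trans (cong (A i j *_) (K≡0 j N<j)) (ℤP.*-zeroʳ (A i j))
  ∇beyondN : ∀ k → N < k → (+ k) ^ i * ∇ (suc i) K k ≡ 0ℤ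
  ∇beyondN k N<k =
    trans (cong ((+ k) ^ i *_) (∇-vanishesAbove (suc i) K≡0 k N<k)) (ℤP.*-zeroʳ ((+ k) ^ i))
  expandEulerian : ∀ j → A i j * K j ≡ ∑[ t < suc j ] f (j ℕ.∸ t) t
  expandEulerian j = begin
    A i j * K j                       ≡⟨ cong (_* K j) (Σ₀-as-∑ j term) ⟩
    ∑< (suc j) term * K j             ≡⟨ ∑-distribʳ (suc j) (K j) term ⟨
    ∑[ t < suc j ] (term t * K j)     ≡⟨ ∑-cong-< (suc j) (λ t t<1+j → asProduct t (ℕP.≤-pred t<1+j)) ⟩
    ∑[ t < suc j ] f (j ℕ.∸ t) t      ∎
    where
    term : ℕ → ℤ
    term t = sgn t * + ((i ℕ.+ 1) C t) * + ((j ℕ.∸ t) ℕ.^ i)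
    asProduct : ∀ t → t ≤ j → term t * K j ≡ f (j ℕ.∸ t) t
    asProduct t t≤j = begin
      sgn t * + ((i ℕ.+ 1) C t) * + ((j ℕ.∸ t) ℕ.^ i) * K j
        ≡⟨ cong₂ (λ n x → sgn t * + (n C t) * x * K j) (ℕP.+-comm i 1) (pos-^ (j ℕ.∸ t) i) ⟩
      sgn t * + (suc i C t) * (+ (j ℕ.∸ t)) ^ i * K j
        ≡⟨ reorder (sgn t) (+ (suc i C t)) ((+ (j ℕ.∸ t)) ^ i) (K j) ⟩
      (+ (j ℕ.∸ t)) ^ i * (+ (suc i C t) * (sgn t * K j))
        ≡⟨ cong (λ n → (+ (j ℕ.∸ t)) ^ i * (+ (suc i C t) * (sgn t * K n))) (ℕP.m∸n+n≡m t≤j) ⟨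
      f (j ℕ.∸ t) t
        ∎
      where
      reorder : ∀ a b c d → a * b * c * d ≡ c * (b * (a * d))
      reorder = solve-∀
  beyondSupport : ∀ k t → M ℕ.∸ k ≤ t → f k t ≡ 0ℤ
  beyondSupport k t M∸k≤t =
    trans (cong (λ x → (+ k) ^ i * (+ (suc i C t) * (sgn t * x))) (K≡0 (k ℕ.+ t) (N<M M≤k+t)))
          (annihilate ((+ k) ^ i) (+ (suc i C t)) (sgn t))
    where
    M≤k+t : M ≤ k ℕ.+ t
    M≤k+t = ℕP.≤-trans (ℕP.m≤n+m∸n M k) (ℕP.+-monoʳ-≤ k M∸k≤t)
    annihilate : ∀ a b c → a * (b * (c * 0ℤ)) ≡ 0ℤ
    annihilate = solve-∀
  beyondBinomial : ∀ k t → suc (suc i) ≤ t → f k t ≡ 0ℤ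
  beyondBinomial k t 2+i≤t rewrite k>n⇒nCk≡0 2+i≤t = ℤP.*-zeroʳ ((+ k) ^ i)

binomial : ∀ m (a b : ℤ) → (a + b) ^ m ≡ ∑[ s < suc m ] (+ (m C s) * (a ^ (m ℕ.∸ s) * b ^ s))
binomial zero    a b = refl
binomial (suc m) a b = begin
  (a + b) * (a + b) ^ m
    ≡⟨ cong ((a + b) *_) (binomial m a b) ⟩
  (a + b) * ∑< (suc m) term
    ≡⟨ ℤP.*-distribʳ-+ (∑< (suc m) term) a b ⟩
  a * ∑< (suc m) term + b * ∑< (suc m) term
    ≡⟨ cong₂ _+_ (trans (sym (∑-distribˡ (suc m) a term))
                        (∑-cong-< (suc m) (λ s s<1+m → timesA s (ℕP.≤-pred s<1+m))))
                 (trans (sym (∑-distribˡ (suc m) b term)) (∑-cong (suc m) timesB)) ⟩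
  ∑[ s < suc m ] (+ (m C s) * w s) + ∑[ s < suc m ] (+ (m C s) * w (suc s))
    ≡⟨ ∑-pascal m w ⟨
  ∑[ s < suc (suc m) ] (+ (suc m C s) * w s)
    ∎
  where
  open ≡-Reasoning
  term : ℕ → ℤ
  term s = + (m C s) * (a ^ (m ℕ.∸ s) * b ^ s)
  w : ℕ → ℤ
  w s = a ^ (suc m ℕ.∸ s) * b ^ s
  timesA : ∀ s → s ≤ m → a * term s ≡ + (m C s) * w s
  timesA s s≤m rewrite ℕP.+-∸-assoc 1 s≤m = reorder a (+ (m C s)) (a ^ (m ℕ.∸ s)) (b ^ s)
    where
    reorder : ∀ a c x y → a * (c * (x * y)) ≡ c * ((a * x) * y)
    reorder = solve-∀
  timesB : ∀ s → b * term s ≡ + (m C s) * w (suc s)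
  timesB s = reorder b (+ (m C s)) (a ^ (m ℕ.∸ s)) (b ^ s)
    where
    reorder : ∀ b c x y → b * (c * (x * y)) ≡ c * (x * (b * y))
    reorder = solve-∀

-- Φ m x K stands for Σₖ (x + k)ᵐ ∇ᵐ⁺¹ K k (Φ-as-∑), but only involves K 0, …, K m.
Φ : ℕ → ℤ → (ℕ → ℤ) → ℤ
Φ m x K = ∑[ s < suc m ] (+ (m C s) * (x ^ (m ℕ.∸ s) * eulerianSum s (∇ (m ℕ.∸ s) K)))

Φ-as-∑ : ∀ m n N (K : ℕ → ℤ) → VanishesAbove N K →
  Φ m (+ n) K ≡ ∑[ k < suc N ] ((+ (n ℕ.+ k)) ^ m * ∇ (suc m) K k)
Φ-as-∑ m n N K K≡0 = begin
  Φ m (+ n) K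
    ≡⟨ ∑-cong-< (suc m) (λ s s<1+m → expand s (ℕP.≤-pred s<1+m)) ⟩
  ∑[ s < suc m ] ∑[ k < suc N ] (+ (m C s) * ((+ n) ^ (m ℕ.∸ s) * (+ k) ^ s) * ∇ (suc m) K k)
    ≡⟨ ∑-swap (suc m) (suc N) _ ⟩
  ∑[ k < suc N ] ∑[ s < suc m ] (+ (m C s) * ((+ n) ^ (m ℕ.∸ s) * (+ k) ^ s) * ∇ (suc m) K k)
    ≡⟨ ∑-cong (suc N) (λ k → trans (∑-distribʳ (suc m) (∇ (suc m) K k) _)
                                   (cong (_* ∇ (suc m) K k) (sym (binomial m (+ n) (+ k))))) ⟩
  ∑[ k < suc N ] ((+ (n ℕ.+ k)) ^ m * ∇ (suc m) K k)
    ∎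
  where
  open ≡-Reasoning
  expand : ∀ s → s ≤ m →
    + (m C s) * ((+ n) ^ (m ℕ.∸ s) * eulerianSum s (∇ (m ℕ.∸ s) K)) ≡
    ∑[ k < suc N ] (+ (m C s) * ((+ n) ^ (m ℕ.∸ s) * (+ k) ^ s) * ∇ (suc m) K k)
  expand s s≤m = begin
    + (m C s) * ((+ n) ^ (m ℕ.∸ s) * eulerianSum s (∇ (m ℕ.∸ s) K))
      ≡⟨ cong (λ e → + (m C s) * ((+ n) ^ (m ℕ.∸ s) * e))
              (trans (eulerianSum-∇ s N (∇ (m ℕ.∸ s) K) (∇-vanishesAbove (m ℕ.∸ s) K≡0))
                     (∑-cong (suc N) (λ k → cong ((+ k) ^ s *_) composeDifferences))) ⟩
    + (m C s) * ((+ n) ^ (m ℕ.∸ s) * ∑[ k < suc N ] ((+ k) ^ s * ∇ (suc m) K k))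
      ≡⟨ cong (+ (m C s) *_) (∑-distribˡ (suc N) ((+ n) ^ (m ℕ.∸ s)) _) ⟨
    + (m C s) * ∑[ k < suc N ] ((+ n) ^ (m ℕ.∸ s) * ((+ k) ^ s * ∇ (suc m) K k))
      ≡⟨ ∑-distribˡ (suc N) (+ (m C s)) _ ⟨
    ∑[ k < suc N ] (+ (m C s) * ((+ n) ^ (m ℕ.∸ s) * ((+ k) ^ s * ∇ (suc m) K k)))
      ≡⟨ ∑-cong (suc N) (λ k → reassociate (+ (m C s)) ((+ n) ^ (m ℕ.∸ s)) ((+ k) ^ s) _) ⟩
    ∑[ k < suc N ] (+ (m C s) * ((+ n) ^ (m ℕ.∸ s) * (+ k) ^ s) * ∇ (suc m) K k)
      ∎
    where
    composeDifferences : ∀ {k} → ∇ (suc s) (∇ (m ℕ.∸ s) K) k ≡ ∇ (suc m) K k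
    composeDifferences {k} =
      trans (∇-∇ (suc s) (m ℕ.∸ s) K k) (cong (λ p → ∇ (suc p) K k) (ℕP.m+[n∸m]≡n s≤m))
    reassociate : ∀ a b c d → a * (b * (c * d)) ≡ a * (b * c) * d
    reassociate = solve-∀

Φ-step-vanishesAbove : ∀ m n N (K : ℕ → ℤ) → VanishesAbove (suc N) K →
  Φ m (+ suc n) (λ j → K (suc j)) - Φ m (+ n) K ≡ - ((+ n) ^ m * ∇ (suc m) K 0)
Φ-step-vanishesAbove m n N K K≡0 = begin
  Φ m (+ suc n) (λ j → K (suc j)) - Φ m (+ n) K
    ≡⟨ cong₂ _-_ (Φ-as-∑ m (suc n) N (λ j → K (suc j)) (λ j N<j → K≡0 (suc j) (s≤s N<j)))
                 (trans (Φ-as-∑ m n (suc N) K K≡0) (∑-suc (suc N) term)) ⟩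
  ∑[ k < suc N ] ((+ (suc n ℕ.+ k)) ^ m * ∇ (suc m) K (suc k)) - (term 0 + ∑[ k < suc N ] term (suc k))
    ≡⟨ cong (λ e → e - (term 0 + ∑[ k < suc N ] term (suc k)))
            (∑-cong (suc N) (λ k → cong (λ i → (+ i) ^ m * ∇ (suc m) K (suc k)) (sym (ℕP.+-suc n k)))) ⟩
  ∑[ k < suc N ] term (suc k) - (term 0 + ∑[ k < suc N ] term (suc k))
    ≡⟨ cancel (∑[ k < suc N ] term (suc k)) (term 0) ⟩
  - term 0
    ≡⟨ cong (λ i → - ((+ i) ^ m * ∇ (suc m) K 0)) (ℕP.+-identityʳ n) ⟩
  - ((+ n) ^ m * ∇ (suc m) K 0)
    ∎
  where
  open ≡-Reasoning
  term : ℕ → ℤ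
  term k = (+ (n ℕ.+ k)) ^ m * ∇ (suc m) K k
  cancel : ∀ a b → a - (b + a) ≡ - b
  cancel = solve-∀

truncate : ℕ → (ℕ → ℤ) → ℕ → ℤ
truncate N K j with j ℕP.≤? N
... | yes _ = K j
... | no  _ = 0ℤ

truncate-≤ : ∀ N K j → j ≤ N → truncate N K j ≡ K j
truncate-≤ N K j j≤N with j ℕP.≤? N
... | yes _   = refl
... | no  j≰N = contradiction j≤N j≰N

truncate-vanishesAbove : ∀ N K → VanishesAbove N (truncate N K)
truncate-vanishesAbove N K j N<j with j ℕP.≤? N
... | yes j≤N = contradiction N<j (ℕP.≤⇒≯ j≤N)
... | no  _   = refl

Φ-local : ∀ m x {K K′ : ℕ → ℤ} → (∀ j → j ≤ m → K j ≡ K′ j) → Φ m x K ≡ Φ m x K′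
Φ-local m x {K} {K′} K≡K′ = ∑-cong-< (suc m) (λ s s<1+m →
  cong (λ e → + (m C s) * (x ^ (m ℕ.∸ s) * e)) (∑-cong-< (suc s) (λ j j<1+s →
    cong (A s j *_) (∇-local (m ℕ.∸ s) K K′ j (λ t t≤m∸s →
      K≡K′ (j ℕ.+ t) (inWindow (ℕP.≤-pred s<1+m) (ℕP.≤-pred j<1+s) t≤m∸s))))))
  where
  inWindow : ∀ {s j t} → s ≤ m → j ≤ s → t ≤ m ℕ.∸ s → j ℕ.+ t ≤ m
  inWindow s≤m j≤s t≤m∸s = subst (_ ≤_) (ℕP.m+[n∸m]≡n s≤m) (ℕP.+-mono-≤ j≤s t≤m∸s)

Φ-step : ∀ m n (K : ℕ → ℤ) →
  Φ m (+ suc n) (λ j → K (suc j)) - Φ m (+ n) K ≡ - ((+ n) ^ m * ∇ (suc m) K 0)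
Φ-step m n K = begin
  Φ m (+ suc n) (λ j → K (suc j)) - Φ m (+ n) K
    ≡⟨ cong₂ _-_ (Φ-local m (+ suc n) (λ j j≤m → agree (suc j) (s≤s j≤m)))
                 (Φ-local m (+ n) (λ j j≤m → agree j (ℕP.m≤n⇒m≤1+n j≤m))) ⟩
  Φ m (+ suc n) (λ j → K′ (suc j)) - Φ m (+ n) K′
    ≡⟨ Φ-step-vanishesAbove m n m K′ (truncate-vanishesAbove (suc m) K) ⟩
  - ((+ n) ^ m * ∇ (suc m) K′ 0)
    ≡⟨ cong (λ e → - ((+ n) ^ m * e)) (∇-local (suc m) K K′ 0 (λ t t≤1+m → agree t t≤1+m)) ⟨
  - ((+ n) ^ m * ∇ (suc m) K 0)
    ∎
  where
  open ≡-Reasoning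
  K′ : ℕ → ℤ
  K′ = truncate (suc m) K
  agree : ∀ j → j ≤ suc m → K j ≡ K′ j
  agree j j≤1+m = sym (truncate-≤ (suc m) K j j≤1+m)

FibonacciLike : (ℤ → ℤ) → Set
FibonacciLike X = ∀ z → X (z + + 2) ≡ X (z + 1ℤ) + X z

seqℤ-fibonacciLike : ∀ a b → FibonacciLike (seqℤ a b)
seqℤ-fibonacciLike a b (+ n) rewrite ℕP.+-comm n 2 | ℕP.+-comm n 1 =
  ℤP.+-comm (proj₁ (fwd a b n)) (proj₂ (fwd a b n))
seqℤ-fibonacciLike a b -[1+ zero ] = backwards a b
  where
  backwards : ∀ a b → b ≡ a + (b - a)
  backwards = solve-∀
seqℤ-fibonacciLike a b -[1+ suc zero ] = backwards a b
  where
  backwards : ∀ a b → a ≡ (b - a) + (a - (b - a))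
  backwards = solve-∀
seqℤ-fibonacciLike a b -[1+ suc (suc n) ] = backwards (proj₁ (bwd a b (suc n))) (proj₂ (bwd a b (suc n)))
  where
  backwards : ∀ x y → x ≡ (y - x) + (x - (y - x))
  backwards = solve-∀

sgn-sq : ∀ s → sgn s * sgn s ≡ 1ℤ
sgn-sq zero    = refl
sgn-sq (suc s) = trans (squareNeg (sgn s)) (sgn-sq s)
  where
  squareNeg : ∀ a → (- 1ℤ * a) * (- 1ℤ * a) ≡ a * a
  squareNeg = solve-∀

sgn-∸ : ∀ {m s} → s ≤ m → sgn m * sgn (m ℕ.∸ s) ≡ sgn s
sgn-∸ {m} {s} s≤m = begin
  sgn m * sgn d                ≡⟨ cong (λ k → sgn k * sgn d) (ℕP.m+[n∸m]≡n s≤m) ⟨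
  sgn (s ℕ.+ d) * sgn d        ≡⟨ cong (_* sgn d) (ℤP.^-distribˡ-+-* (- 1ℤ) s d) ⟩
  sgn s * sgn d * sgn d        ≡⟨ ℤP.*-assoc (sgn s) (sgn d) (sgn d) ⟩
  sgn s * (sgn d * sgn d)      ≡⟨ cong (sgn s *_) (sgn-sq d) ⟩
  sgn s * 1ℤ                   ≡⟨ ℤP.*-identityʳ (sgn s) ⟩
  sgn s                        ∎
  where
  open ≡-Reasoning
  d : ℕ
  d = m ℕ.∸ s

-- On a Fibonacci-like sequence, (1 − E) H z = H z − H (z + 1) = − H (z − 1).
∇-fibonacciLike : ∀ H → FibonacciLike H → ∀ p c j →
  ∇ p (λ t → H (c + + t)) j ≡ sgn p * H (c + + j - + p)
∇-fibonacciLike H fib zero c j =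
  trans (∇-zeroth (λ t → H (c + + t)) j)
        (sym (trans (ℤP.*-identityˡ _) (cong H (ℤP.+-identityʳ (c + + j)))))
∇-fibonacciLike H fib (suc p) c j = begin
  ∇ (suc p) K j
    ≡⟨ ∇-suc p K j ⟩
  ∇ p K j - ∇ p K (suc j)
    ≡⟨ cong₂ _-_ (∇-fibonacciLike H fib p c j) (∇-fibonacciLike H fib p c (suc j)) ⟩
  sgn p * H (c + + j - + p) - sgn p * H (c + (1ℤ + + j) - + p)
    ≡⟨ cong (λ z → sgn p * H (c + + j - + p) - sgn p * H z) (twoBack c (+ j) (+ p)) ⟩
  sgn p * H (c + + j - + p) - sgn p * H (c + + j - (1ℤ + + p) + + 2)
    ≡⟨ cong (λ h → sgn p * H (c + + j - + p) - sgn p * h) (fib (c + + j - (1ℤ + + p))) ⟩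
  sgn p * H (c + + j - + p) - sgn p * (H (c + + j - (1ℤ + + p) + 1ℤ) + H (c + + j - (1ℤ + + p)))
    ≡⟨ cong (λ z → sgn p * H (c + + j - + p) - sgn p * (H z + H (c + + j - (1ℤ + + p))))
            (oneBack c (+ j) (+ p)) ⟩
  sgn p * H (c + + j - + p) - sgn p * (H (c + + j - + p) + H (c + + j - (1ℤ + + p)))
    ≡⟨ collapse (sgn p) (H (c + + j - + p)) (H (c + + j - (1ℤ + + p))) ⟩
  sgn (suc p) * H (c + + j - + suc p)
    ∎
  where
  open ≡-Reasoning
  K : ℕ → ℤ
  K t = H (c + + t)
  twoBack : ∀ c j p → c + (1ℤ + j) - p ≡ c + j - (1ℤ + p) + + 2
  twoBack = solve-∀
  oneBack : ∀ c j p → c + j - (1ℤ + p) + 1ℤ ≡ c + j - p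
  oneBack = solve-∀
  collapse : ∀ s x y → s * x - s * (x + y) ≡ - 1ℤ * s * y
  collapse = solve-∀

antidifference : (ℤ → ℤ) → ℤ → ℕ → ℕ → ℤ
antidifference X r m n = ∑[ s < suc m ]
  (+ (m C s) * ((+ n) ^ (m ℕ.∸ s) * (sgn s * eulerianSum s (λ j → X (+ j + + n + + s + r + + 1)))))

antidifference-as-Φ : ∀ X r m n → FibonacciLike X →
  antidifference X r m n ≡ sgn m * Φ m (+ n) (λ j → X (+ n + + m + r + 1ℤ + + j))
antidifference-as-Φ X r m n fib =
  trans (∑-cong-< (suc m) (λ s s<1+m → term s (ℕP.≤-pred s<1+m))) (∑-distribˡ (suc m) (sgn m) _)
  where
  c : ℤ
  c = + n + + m + r + 1ℤ
  K : ℕ → ℤ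
  K j = X (c + + j)
  T : ℕ → ℤ
  T s = eulerianSum s (λ j → X (+ j + + n + + s + r + + 1))
  differences : ∀ s → s ≤ m → eulerianSum s (∇ (m ℕ.∸ s) K) ≡ sgn (m ℕ.∸ s) * T s
  differences s s≤m = trans (∑-cong (suc s) (λ j → cong (A s j *_) (begin
      ∇ (m ℕ.∸ s) (λ t → X (c + + t)) j
        ≡⟨ ∇-fibonacciLike X fib (m ℕ.∸ s) c j ⟩
      sgn (m ℕ.∸ s) * X (c + + j - + (m ℕ.∸ s))
        ≡⟨ cong (λ z → sgn (m ℕ.∸ s) * X (c + + j - z)) (pos-∸ s≤m) ⟩
      sgn (m ℕ.∸ s) * X (c + + j - (+ m - + s))
        ≡⟨ cong (λ z → sgn (m ℕ.∸ s) * X z) (index (+ n) (+ m) r (+ j) (+ s)) ⟩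
      sgn (m ℕ.∸ s) * X (+ j + + n + + s + r + + 1)
        ∎)))
    (trans (∑-cong (suc s) (λ j → swap (A s j) (sgn (m ℕ.∸ s)) _))
           (∑-distribˡ (suc s) (sgn (m ℕ.∸ s)) _))
    where
    open ≡-Reasoning
    index : ∀ n m r j s → n + m + r + 1ℤ + j - (m - s) ≡ j + n + s + r + + 1
    index = solve-∀
    swap : ∀ a b x → a * (b * x) ≡ b * (a * x)
    swap = solve-∀
  term : ∀ s → s ≤ m →
    + (m C s) * ((+ n) ^ (m ℕ.∸ s) * (sgn s * T s)) ≡
    sgn m * (+ (m C s) * ((+ n) ^ (m ℕ.∸ s) * eulerianSum s (∇ (m ℕ.∸ s) K)))
  term s s≤m rewrite differences s s≤m | sym (sgn-∸ s≤m) =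
    reorder (+ (m C s)) ((+ n) ^ (m ℕ.∸ s)) (sgn m) (sgn (m ℕ.∸ s)) (T s)
    where
    reorder : ∀ b p x y t → b * (p * (x * y * t)) ≡ x * (b * (p * (y * t)))
    reorder = solve-∀

antidifference-step : ∀ X r m n → FibonacciLike X →
  antidifference X r m (suc n) - antidifference X r m n ≡ (+ n) ^ m * X (+ n + r)
antidifference-step X r m n fib = begin
  antidifference X r m (suc n) - antidifference X r m n
    ≡⟨ cong₂ _-_ (trans (antidifference-as-Φ X r m (suc n) fib) (cong (sgn m *_) (Φ-local m (+ suc n) shift)))
                 (antidifference-as-Φ X r m n fib) ⟩
  sgn m * Φ m (+ suc n) (λ j → K (suc j)) - sgn m * Φ m (+ n) K
    ≡⟨ factor (sgn m) _ _ ⟩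
  sgn m * (Φ m (+ suc n) (λ j → K (suc j)) - Φ m (+ n) K)
    ≡⟨ cong (sgn m *_) (Φ-step m n K) ⟩
  sgn m * - ((+ n) ^ m * ∇ (suc m) K 0)
    ≡⟨ cong (λ e → sgn m * - ((+ n) ^ m * e)) (∇-fibonacciLike X fib (suc m) c 0) ⟩
  sgn m * - ((+ n) ^ m * (- 1ℤ * sgn m * X (c + + 0 - + suc m)))
    ≡⟨ cong (λ z → sgn m * - ((+ n) ^ m * (- 1ℤ * sgn m * X z))) (baseIndex (+ n) (+ m) r) ⟩
  sgn m * - ((+ n) ^ m * (- 1ℤ * sgn m * X (+ n + r)))
    ≡⟨ reorder (sgn m) ((+ n) ^ m) (X (+ n + r)) ⟩
  sgn m * sgn m * ((+ n) ^ m * X (+ n + r))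
    ≡⟨ cong (_* ((+ n) ^ m * X (+ n + r))) (sgn-sq m) ⟩
  1ℤ * ((+ n) ^ m * X (+ n + r))
    ≡⟨ ℤP.*-identityˡ _ ⟩
  (+ n) ^ m * X (+ n + r)
    ∎
  where
  open ≡-Reasoning
  c : ℤ
  c = + n + + m + r + 1ℤ
  K : ℕ → ℤ
  K j = X (c + + j)
  shift : ∀ j → j ≤ m → X (+ suc n + + m + r + 1ℤ + + j) ≡ K (suc j)
  shift j _ = cong X (shiftIndex (+ n) (+ m) r (+ j))
    where
    shiftIndex : ∀ n m r j → (1ℤ + n) + m + r + 1ℤ + j ≡ n + m + r + 1ℤ + (1ℤ + j)
    shiftIndex = solve-∀
  baseIndex : ∀ n m r → n + m + r + 1ℤ + + 0 - (1ℤ + m) ≡ n + r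
  baseIndex = solve-∀
  factor : ∀ s a b → s * a - s * b ≡ s * (a - b)
  factor = solve-∀
  reorder : ∀ s a x → s * - (a * (- 1ℤ * s * x)) ≡ s * s * (a * x)
  reorder = solve-∀

powerSum-antidifference : ∀ X r m n → FibonacciLike X →
  ∑[ k < n ] ((+ k) ^ m * X (+ k + r)) ≡ antidifference X r m n - antidifference X r m 0
powerSum-antidifference X r m n fib =
  trans (∑-cong n (λ k → sym (antidifference-step X r m k fib))) (∑-telescope n (antidifference X r m))

eulerianSum-zero : ∀ f → eulerianSum 0 f ≡ f 0
eulerianSum-zero f = trans (ℤP.+-identityˡ (A 0 0 * f 0)) (ℤP.*-identityˡ (f 0))

-- The j = 0 term vanishes by computation: A (suc s) 0 reduces to 0 ^ suc s.
eulerianSum-suc : ∀ s f → eulerianSum (suc s) f ≡ Σ[ 1 ≤ (λ j → A (suc s) j * f j) ≤ suc s ]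
eulerianSum-suc s f =
  trans (∑-suc (suc s) (λ j → A (suc s) j * f j))
        (trans (ℤP.+-identityˡ _) (sym (Σ₁-as-∑ (suc s) (λ j → A (suc s) j * f j))))

module _ (X : ℤ → ℤ) (r : ℤ) (m n : ℕ) where

  innerSum : ℕ → ℤ
  innerSum s = Σ[ 1 ≤ (λ j → A s j * X (+ j + + n + + s + r + + 1)) ≤ s ]

  outerTerm : ℕ → ℤ
  outerTerm s = sgn (suc s) * + (m C s) * (+ n) ^ (m ℕ.∸ s) * innerSum s

  outerSum : ℤ
  outerSum = Σ[ 1 ≤ outerTerm ≤ m ]

  antidifference-split : antidifference X r m n ≡ (+ n) ^ m * X (+ n + r + 1ℤ) - outerSum
  antidifference-split = begin
    antidifference X r m n
      ≡⟨ ∑-suc m _ ⟩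
    term 0 + ∑[ s < m ] term (suc s)
      ≡⟨ cong₂ _+_ leadingTerm (trans (∑-cong m (λ s → higherTerm s)) (∑-neg m _)) ⟩
    (+ n) ^ m * X (+ n + r + 1ℤ) + - ∑[ s < m ] outerTerm (suc s)
      ≡⟨ cong (λ e → (+ n) ^ m * X (+ n + r + 1ℤ) - e) (sym (Σ₁-as-∑ m outerTerm)) ⟩
    (+ n) ^ m * X (+ n + r + 1ℤ) - outerSum
      ∎
    where
    open ≡-Reasoning
    term : ℕ → ℤ
    term s = + (m C s) * ((+ n) ^ (m ℕ.∸ s) * (sgn s * eulerianSum s (λ j → X (+ j + + n + + s + r + + 1))))
    leadingTerm : term 0 ≡ (+ n) ^ m * X (+ n + r + 1ℤ)
    leadingTerm =
      trans (cong (λ e → 1ℤ * ((+ n) ^ m * (1ℤ * e)))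
                  (trans (eulerianSum-zero (λ j → X (+ j + + n + + 0 + r + + 1))) (cong X (index (+ n) r))))
            (units ((+ n) ^ m) (X (+ n + r + 1ℤ)))
      where
      index : ∀ n r → + 0 + n + + 0 + r + + 1 ≡ n + r + 1ℤ
      index = solve-∀
      units : ∀ a x → 1ℤ * (a * (1ℤ * x)) ≡ a * x
      units = solve-∀
    higherTerm : ∀ s → term (suc s) ≡ - outerTerm (suc s)
    higherTerm s rewrite eulerianSum-suc s (λ j → X (+ j + + n + + suc s + r + + 1)) =
      reorder (sgn (suc s)) (+ (m C suc s)) ((+ n) ^ (m ℕ.∸ suc s)) (innerSum (suc s))
      where
      reorder : ∀ a c p t → c * (p * (a * t)) ≡ - (- 1ℤ * a * c * p * t)
      reorder = solve-∀

antidifference-zero : ∀ X r m →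
  antidifference X r m 0 ≡ sgn m * Σ[ 0 ≤ (λ j → A m j * X (+ j + + m + r + + 1)) ≤ m ]
antidifference-zero X r m = begin
  ∑< m term + term m
    ≡⟨ cong₂ _+_ (∑-zero m (λ s s<m → vanishes s s<m)) lastTerm ⟩
  0ℤ + sgn m * eulerianSum m (λ j → X (+ j + + m + r + + 1))
    ≡⟨ ℤP.+-identityˡ _ ⟩
  sgn m * eulerianSum m (λ j → X (+ j + + m + r + + 1))
    ≡⟨ cong (sgn m *_) (Σ₀-as-∑ m (λ j → A m j * X (+ j + + m + r + + 1))) ⟨
  sgn m * Σ[ 0 ≤ (λ j → A m j * X (+ j + + m + r + + 1)) ≤ m ]
    ∎
  where
  open ≡-Reasoning
  T : ℕ → ℤ
  T s = eulerianSum s (λ j → X (+ j + + 0 + + s + r + + 1))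
  term : ℕ → ℤ
  term s = + (m C s) * ((+ 0) ^ (m ℕ.∸ s) * (sgn s * T s))
  vanishes : ∀ s → s < m → term s ≡ 0ℤ
  vanishes s s<m =
    trans (cong (λ e → + (m C s) * ((+ 0) ^ e * (sgn s * T s))) (ℕP.+-∸-assoc 1 s<m))
          (annihilate (+ (m C s)) ((+ 0) ^ (m ℕ.∸ suc s)) (sgn s * T s))
    where
    annihilate : ∀ c p x → c * ((+ 0 * p) * x) ≡ 0ℤ
    annihilate = solve-∀
  lastTerm : term m ≡ sgn m * eulerianSum m (λ j → X (+ j + + m + r + + 1))
  lastTerm rewrite nCn≡1 m | ℕP.n∸n≡0 m =
    trans (units (sgn m * T m))
          (cong (sgn m *_) (∑-cong (suc m) (λ j → cong (λ z → A m j * X z) (index (+ j) (+ m) r))))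
    where
    units : ∀ x → 1ℤ * (1ℤ * x) ≡ x
    units = solve-∀
    index : ∀ j m r → j + + 0 + m + r + + 1 ≡ j + m + r + + 1
    index = solve-∀

δ0-as-power : ∀ m → δ0 m ≡ (+ 0) ^ m
δ0-as-power zero    = refl
δ0-as-power (suc m) = refl

powerSum-closedForm : ∀ X r m n → FibonacciLike X → LHS X m n r ≡ RHS X m n r
powerSum-closedForm X r m n fib = begin
  LHS X m n r
    ≡⟨ Σ₁-as-∑ n (λ k → (+ k) ^ m * X (+ k + r)) ⟩
  ∑[ k < n ] φ (suc k)
    ≡⟨ addSubtract (φ 0) _ ⟩
  φ 0 + ∑[ k < n ] φ (suc k) - φ 0
    ≡⟨ cong (_- φ 0) (∑-suc n φ) ⟨
  ∑< n φ + φ n - φ 0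
    ≡⟨ cong (λ e → e + φ n - φ 0) (powerSum-antidifference X r m n fib) ⟩
  antidifference X r m n - antidifference X r m 0 + φ n - φ 0
    ≡⟨ cong₂ (λ a b → a - b + φ n - φ 0) (antidifference-split X r m n) (antidifference-zero X r m) ⟩
  (+ n) ^ m * X (+ n + r + 1ℤ) - outerSum X r m n - sgn m * E + (+ n) ^ m * X (+ n + r) - φ 0
    ≡⟨ rearrange (φ 0) ((+ n) ^ m) (X (+ n + r + 1ℤ)) (X (+ n + r)) (sgn m) E (outerSum X r m n) ⟩
  - φ 0 + (+ n) ^ m * (X (+ n + r + 1ℤ) + X (+ n + r)) + sgn (suc m) * E - outerSum X r m n
    ≡⟨ cong₂ (λ a b → - a + (+ n) ^ m * b + sgn (suc m) * E - outerSum X r m n)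
             (cong₂ _*_ (sym (δ0-as-power m)) (cong X (ℤP.+-identityˡ r)))
             (sym (fib (+ n + r))) ⟩
  RHS X m n r
    ∎
  where
  open ≡-Reasoning
  φ : ℕ → ℤ
  φ k = (+ k) ^ m * X (+ k + r)
  E : ℤ
  E = Σ[ 0 ≤ (λ j → A m j * X (+ j + + m + r + + 1)) ≤ m ]
  addSubtract : ∀ a p → p ≡ a + p - a
  addSubtract = solve-∀
  rearrange : ∀ z N x₁ x₀ s e o →
    N * x₁ - o - s * e + N * x₀ - z ≡ - z + N * (x₁ + x₀) + - 1ℤ * s * e - o
  rearrange = solve-∀

mainTheorem5 : (m n : ℕ) (r : ℤ) →
    (LHS F m n r ≡ RHS F m n r) × (LHS L m n r ≡ RHS L m n r)
mainTheorem5 m n r =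
  powerSum-closedForm F r m n (seqℤ-fibonacciLike (+ 0) (+ 1)) ,
  powerSum-closedForm L r m n (seqℤ-fibonacciLike (+ 2) (+ 1))
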